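{- Let $q$ be an odd prime power. Then $M_1(x^{q-2},0)=q$. If $q\equiv1\pmod4$: for $c\in C_0^{(2,q)}$, $M_0(x^{q-2},c)=\frac{q-1}{2}$, $M_1(x^{q-2},c)=2$, $M_2(x^{q-2},c)=\frac{q-5}{2}$, $M_3(x^{q-2},c)=1$; for $c\in C_1^{(2,q)}$, $M_0(x^{q-2},c)=\frac{q-1}{2}$, $M_1(x^{q-2},c)=1$, $M_2(x^{q-2},c)=\frac{q-1}{2}$. If $q\equiv3\pmod4$: for $c\in C_0^{(2,q)}$, $M_0(x^{q-2},c)=\frac{q+1}{2}$, $M_2(x^{q-2},c)=\frac{q-3}{2}$, $M_3(x^{q-2},c)=1$; for $c\in C_1^{(2,q)}$, $M_0(x^{q-2},c)=\frac{q-3}{2}$, $M_1(x^{q-2},c)=3$, $M_2(x^{q-2},c)=\frac{q-3}{2}$. In each case all $M_j(x^{q-2},c)$ not listed are $0$.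
   Context: For a polynomial $f$ over $\mathbb{F}_q$ and $c\in\mathbb{F}_q$, $M_j(f,c)$ is the number of elements of $\mathbb{F}_q$ occurring exactly $j$ times in the multiset $\{f(x)-cx\mid x\in\mathbb{F}_q\}$. For $q$ odd, $C_0^{(2,q)}$ is the set of nonzero squares of $\mathbb{F}_q$ and $C_1^{(2,q)}$ the set of nonsquares. -}

module Defs where

open import Data.Nat using (ℕ; zero; suc)
import Data.Nat as ℕ
open import Data.Fin using (Fin)
open import Data.Bool using (Bool; true; false)
open import Data.Product using (∃)
open import Relation.Nullary using (¬_)
open import Relation.Nullary.Decidable using (⌊_⌋)
open import Relation.Binary.PropositionalEquality using (_≡_; _≢_)
open import Relation.Binary.Definitions using (DecidableEquality)
open import Algebra.Core using (Op₁; Op₂)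
open import Algebra.Structures using (IsCommutativeRing)
open import Function.Bundles using (_⤖_; Bijection)

-- A finite field with exactly q elements (equality is propositional).
-- The bijection `enum` with Fin q expresses |F| = q.
record FiniteField (q : ℕ) : Set₁ where
  infixl 6 _+_ _-_
  infixl 7 _*_
  field
    Carrier : Set
    _+_ _*_ : Op₂ Carrier
    -_ : Op₁ Carrier
    0# 1# : Carrier
    isCommutativeRing : IsCommutativeRing _≡_ _+_ _*_ -_ 0# 1#
    0≢1 : 0# ≢ 1#
    inverse : ∀ x → x ≢ 0# → ∃ λ y → x * y ≡ 1#
    _≟_ : DecidableEquality Carrier
    enum : Fin q ⤖ Carrier

  _-_ : Op₂ Carrier
  x - y = x + (- y)

  _^_ : Carrier → ℕ → Carrier
  x ^ zero = 1#
  x ^ suc n = x * (x ^ n)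

  elt : Fin q → Carrier
  elt = Bijection.to enum

count : ∀ {n} → (Fin n → Bool) → ℕ
count {zero} p = 0
count {suc n} p with p Fin.zero
... | true  = suc (count (λ i → p (Fin.suc i)))
... | false = count (λ i → p (Fin.suc i))

module _ {q : ℕ} (F : FiniteField q) where
  open FiniteField F

  multiplicity : (Carrier → Carrier) → Carrier → Carrier → ℕ
  multiplicity f c y = count (λ i → ⌊ (f (elt i) - c * elt i) ≟ y ⌋)

  M : ℕ → (Carrier → Carrier) → Carrier → ℕ
  M j f c = count (λ k → ⌊ multiplicity f c (elt k) ℕ.≟ j ⌋)

  C₀ : Carrier → Set
  C₀ c = c ≢ 0# Data.Product.× ∃ λ y → y * y ≡ c

  C₁ : Carrier → Set
  C₁ c = c ≢ 0# Data.Product.× ¬ (∃ λ y → y * y ≡ c)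

module Submission where

-- Write ι x = x ^ (q - 2). By Fermat's little theorem ι inverts every x ≠ 0 and fixes 0, so for
-- c = 0 every value is taken once. For c ≠ 0 and x ≠ 0, ι x - c x = y is equivalent to
-- (2cx + y)² = y² + 4c, so y is taken [y = 0] + e(y) times, where e(y) is the number of square
-- roots of y² + 4c: e(y) = 1 exactly when y² = -4c, and e(y) ∈ {0, 2} otherwise. Let T_j count the
-- y ≠ 0 with e(y) = j, and m = 1 + e(0), which is 3 or 1 as c is a square or not. Counting the y ≠ 0,
-- summing all multiplicities, pairing y with -y and counting the square roots of -4c give
--   q = 1 + T₀ + T₁ + T₂,   m + T₁ + 2 T₂ = q,   T₂ even,   T₁ ∈ {0, 2},
-- so m + T₁ ≡ q (mod 4) fixes T₁, and then T₀ and T₂.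

open import Defs
open import Algebra.Bundles using (CommutativeMonoid; CommutativeRing)
import Algebra.Properties.CommutativeMonoid.Sum as CommutativeMonoidSum
import Algebra.Properties.Ring as RingProperties
open import Data.Bool using (Bool; true; false; if_then_else_)
open import Data.Empty using (⊥; ⊥-elim)
open import Data.Fin as Fin using (Fin; toℕ)
open import Data.Fin.Permutation using (permutation)
import Data.Fin.Properties as Fin
import Data.Nat.Properties as ℕ
open import Data.Nat as ℕ using (ℕ; zero; suc; _∸_; _%_; _/_; _<_)
open import Data.Nat.DivMod using (m*n%n≡0; m*n/n≡m; [m+kn]%n≡m%n; m/n≡1+[m∸n]/n)
open import Algebra.Properties.CommutativeSemigroup ℕ.+-commutativeSemigroup using (x∙yz≈y∙xz)
open import Data.Product using (_×_; _,_; ∃; proj₁; proj₂)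
open import Data.Sum as Sum using (_⊎_; inj₁; inj₂; [_,_]′)
open import Function using (id; _∘_; _⇔_; _⤖_; mk⇔; Equivalence; Inverse)
open import Function.Properties.Bijection using (⤖⇒↔)
open import Function.Properties.Equivalence using (⇔-setoid) renaming (trans to ⇔-trans)
open import Level using (0ℓ)
open import Relation.Binary.Definitions using (DecidableEquality)
open import Relation.Binary.PropositionalEquality
  using (_≡_; _≢_; refl; sym; trans; cong; cong₂; subst; module ≡-Reasoning)
open import Relation.Nullary using (¬_; Dec; yes; no)
open import Relation.Nullary.Decidable using (⌊_⌋; ⌊⌋-map′; isYes≗does; does-⇔)

-- ℕ's _+_ is opened only locally: the field modules below use the field's _+_.
module Summation where
  open import Data.Nat using (_+_)

  [_] : ∀ {a} {A : Set a} → Dec A → ℕ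
  [ a? ] = if ⌊ a? ⌋ then 1 else 0

  module _ {a b} {P : Set a} {A : Set b} {u v : A} where

    if-yes : (p? : Dec P) → P → (if ⌊ p? ⌋ then u else v) ≡ u
    if-yes (yes _) _ = refl
    if-yes (no ¬p) p = ⊥-elim (¬p p)

    if-no : (p? : Dec P) → ¬ P → (if ⌊ p? ⌋ then u else v) ≡ v
    if-no (yes p) ¬p = ⊥-elim (¬p p)
    if-no (no _) _ = refl

  []-witness : ∀ {a} {A : Set a} (a? : Dec A) → [ a? ] ≢ 0 → A
  []-witness (yes a) _ = a
  []-witness (no _) [a?]≢0 = ⊥-elim ([a?]≢0 refl)

  module _ {a b} {A : Set a} {B : Set b} where

    ⌊⌋-cong : A ⇔ B → (a? : Dec A) (b? : Dec B) → ⌊ a? ⌋ ≡ ⌊ b? ⌋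
    ⌊⌋-cong A⇔B a? b? = trans (isYes≗does a?) (trans (does-⇔ A⇔B a? b?) (sym (isYes≗does b?)))

    []-cong : A ⇔ B → (a? : Dec A) (b? : Dec B) → [ a? ] ≡ [ b? ]
    []-cong A⇔B a? b? = cong (if_then 1 else 0) (⌊⌋-cong A⇔B a? b?)

    []-⊎ : ∀ {c} {C : Set c} → A ⇔ (B ⊎ C) → (B → ¬ C) → (a? : Dec A) (b? : Dec B) (c? : Dec C) →
           [ a? ] ≡ [ b? ] + [ c? ]
    []-⊎ A⇔B⊎C disjoint a? (yes b) (yes c) = ⊥-elim (disjoint b c)
    []-⊎ A⇔B⊎C disjoint a? (yes b) (no _) = if-yes a? (Equivalence.from A⇔B⊎C (inj₁ b))
    []-⊎ A⇔B⊎C disjoint a? (no _) (yes c) = if-yes a? (Equivalence.from A⇔B⊎C (inj₂ c))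
    []-⊎ A⇔B⊎C disjoint a? (no ¬b) (no ¬c) = if-no a? ([ ¬b , ¬c ]′ ∘ Equivalence.to A⇔B⊎C)

  module FiniteSum {c ℓ} (M : CommutativeMonoid c ℓ) {n} {A : Set} (enum : Fin n ⤖ A) where
    open CommutativeMonoid M using (Carrier; _≈_; _∙_; setoid) renaming (sym to ≈-sym)
    open CommutativeMonoidSum M using (sum; sum-cong-≗; sum-permute; ∑-distrib-+; ∑-comm)
    open Inverse (⤖⇒↔ enum) using (to; from; strictlyInverseˡ; strictlyInverseʳ)

    ∑ : (A → Carrier) → Carrier
    ∑ f = sum (f ∘ to)

    ∑-cong : ∀ {f g : A → Carrier} → (∀ x → f x ≡ g x) → ∑ f ≡ ∑ g
    ∑-cong f≗g = sum-cong-≗ (f≗g ∘ to)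

    ∑-swap : ∀ (f : A → A → Carrier) → ∑ (λ x → ∑ (λ y → f x y)) ≈ ∑ (λ y → ∑ (λ x → f x y))
    ∑-swap f = ∑-comm (λ i j → f (to i) (to j))

    ∑-distrib : ∀ (f g : A → Carrier) → ∑ (λ x → f x ∙ g x) ≈ ∑ f ∙ ∑ g
    ∑-distrib f g = ∑-distrib-+ (f ∘ to) (g ∘ to)

    ∑-reindex : ∀ (σ τ : A → A) → (∀ x → σ (τ x) ≡ x) → (∀ x → τ (σ x) ≡ x) →
                ∀ f → ∑ (f ∘ σ) ≈ ∑ f
    ∑-reindex σ τ στ τσ f = begin
      ∑ (f ∘ σ)            ≡⟨ ∑-cong (λ x → cong f (sym (strictlyInverseˡ (σ x)))) ⟩
      sum (f ∘ to ∘ π)     ≈⟨ ≈-sym (sum-permute (f ∘ to) (permutation π π′ ππ′ π′π)) ⟩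
      ∑ f                  ∎
      where
      open import Relation.Binary.Reasoning.Setoid setoid
      π π′ : Fin n → Fin n
      π i = from (σ (to i))
      π′ i = from (τ (to i))
      ππ′ : ∀ i → π (π′ i) ≡ i
      ππ′ i rewrite strictlyInverseˡ (τ (to i)) | στ (to i) = strictlyInverseʳ i
      π′π : ∀ i → π′ (π i) ≡ i
      π′π i rewrite strictlyInverseˡ (σ (to i)) | τσ (to i) = strictlyInverseʳ i

  module NatSum = CommutativeMonoidSum ℕ.+-0-commutativeMonoid
  open NatSum using (sum; sum-cong-≗; sum-replicate-zero)

  count≡sum : ∀ {n} (p : Fin n → Bool) → count p ≡ sum (λ i → if p i then 1 else 0)
  count≡sum {zero} p = refl
  count≡sum {suc n} p with p Fin.zero
  ... | true = cong suc (count≡sum (p ∘ Fin.suc))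
  ... | false = count≡sum (p ∘ Fin.suc)

  sum-pick : ∀ {n} (f : Fin n → ℕ) (j : Fin n) →
             sum f ≡ f j + sum (λ i → if ⌊ i Fin.≟ j ⌋ then 0 else f i)
  sum-pick f Fin.zero = refl
  sum-pick f (Fin.suc j) = begin
    f Fin.zero + sum (f ∘ Fin.suc)
      ≡⟨ cong (f Fin.zero +_) (sum-pick (f ∘ Fin.suc) j) ⟩
    f Fin.zero + (f (Fin.suc j) + sum (λ i → if ⌊ i Fin.≟ j ⌋ then 0 else f (Fin.suc i)))
      ≡⟨ x∙yz≈y∙xz (f Fin.zero) (f (Fin.suc j)) _ ⟩
    f (Fin.suc j) + (f Fin.zero + sum (λ i → if ⌊ i Fin.≟ j ⌋ then 0 else f (Fin.suc i)))
      ≡⟨ cong (λ s → f (Fin.suc j) + (f Fin.zero + s)) (sum-cong-≗ skip-suc) ⟩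
    f (Fin.suc j) + sum (λ i → if ⌊ i Fin.≟ Fin.suc j ⌋ then 0 else f i) ∎
    where
    open ≡-Reasoning
    skip-suc : ∀ i → (if ⌊ i Fin.≟ j ⌋ then 0 else f (Fin.suc i))
                   ≡ (if ⌊ Fin.suc i Fin.≟ Fin.suc j ⌋ then 0 else f (Fin.suc i))
    skip-suc i = cong (if_then 0 else f (Fin.suc i)) (sym (⌊⌋-map′ _ _ (i Fin.≟ j)))

  sum-nonzero : ∀ {n} (f : Fin n → ℕ) → sum f ≢ 0 → ∃ λ i → f i ≢ 0
  sum-nonzero {zero} f sum≢0 = ⊥-elim (sum≢0 refl)
  sum-nonzero {suc n} f sum≢0 with f Fin.zero ℕ.≟ 0
  ... | no f₀≢0 = Fin.zero , f₀≢0
  ... | yes f₀≡0 with sum-nonzero (f ∘ Fin.suc) (sum≢0 ∘ cong₂ _+_ f₀≡0)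
  ...   | i , fᵢ≢0 = Fin.suc i , fᵢ≢0

  sum-const-1 : ∀ n → sum {n} (λ _ → 1) ≡ n
  sum-const-1 zero = refl
  sum-const-1 (suc n) = cong suc (sum-const-1 n)

  if-split : ∀ b v → v ≡ (if b then v else 0) + (if b then 0 else v)
  if-split true v = sym (ℕ.+-identityʳ v)
  if-split false v = refl

  if-<-swap : ∀ {a b} v → (v ≢ 0 → a ≢ b) →
              (if ⌊ b ℕ.<? a ⌋ then 0 else v) ≡ (if ⌊ a ℕ.<? b ⌋ then v else 0)
  if-<-swap {a} {b} v distinct with b ℕ.<? a | a ℕ.<? b
  ... | yes b<a | yes a<b = ⊥-elim (ℕ.<-asym a<b b<a)
  ... | yes _ | no _ = refl
  ... | no _ | yes _ = refl
  ... | no b≮a | no a≮b with v ℕ.≟ 0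
  ...   | yes v≡0 = v≡0
  ...   | no v≢0 = ⊥-elim (distinct v≢0 (ℕ.≤-antisym (ℕ.≮⇒≥ b≮a) (ℕ.≮⇒≥ a≮b)))

  module Counting {n} {A : Set} (enum : Fin n ⤖ A) (_≟_ : DecidableEquality A) where
    open FiniteSum ℕ.+-0-commutativeMonoid enum public
    open Inverse (⤖⇒↔ enum) using (to; from; strictlyInverseˡ; strictlyInverseʳ)

    _except_ : (A → ℕ) → A → A → ℕ
    (h except a) x = if ⌊ x ≟ a ⌋ then 0 else h x

    ∑-pick : ∀ h a → ∑ h ≡ h a + ∑ (h except a)
    ∑-pick h a = trans (sum-pick (h ∘ to) (from a))
                       (cong₂ _+_ (cong h (strictlyInverseˡ a)) (sum-cong-≗ same-test))
      where
      i≡from-a⇔to-i≡a : ∀ i → (i ≡ from a) ⇔ (to i ≡ a)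
      i≡from-a⇔to-i≡a i = mk⇔ (λ i≡ → trans (cong to i≡) (strictlyInverseˡ a))
                               (λ to-i≡ → trans (sym (strictlyInverseʳ i)) (cong from to-i≡))
      same-test : ∀ i → (if ⌊ i Fin.≟ from a ⌋ then 0 else h (to i)) ≡ (h except a) (to i)
      same-test i = cong (if_then 0 else h (to i)) (⌊⌋-cong (i≡from-a⇔to-i≡a i) _ _)

    ∑-except-null : ∀ h a → h a ≡ 0 → ∑ (h except a) ≡ ∑ h
    ∑-except-null h a ha≡0 = sym (trans (∑-pick h a) (cong (_+ ∑ (h except a)) ha≡0))

    ∑-except-cong : ∀ {f g} a → (∀ x → x ≢ a → f x ≡ g x) → ∑ (f except a) ≡ ∑ (g except a)
    ∑-except-cong {f} {g} a f≡g = ∑-cong pointwise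
      where
      pointwise : ∀ x → (f except a) x ≡ (g except a) x
      pointwise x with x ≟ a
      ... | yes _ = refl
      ... | no x≢a = f≡g x x≢a

    ∑-except-distrib : ∀ f g a → ∑ ((λ x → f x + g x) except a) ≡ ∑ (f except a) + ∑ (g except a)
    ∑-except-distrib f g a = trans (∑-cong pointwise) (∑-distrib (f except a) (g except a))
      where
      pointwise : ∀ x → ((λ x → f x + g x) except a) x ≡ (f except a) x + (g except a) x
      pointwise x with x ≟ a
      ... | yes _ = refl
      ... | no _ = refl

    ∑-zero : ∀ {h} → (∀ x → h x ≡ 0) → ∑ h ≡ 0
    ∑-zero h≡0 = trans (∑-cong h≡0) (sum-replicate-zero n)

    ∑-except-zero : ∀ {h} a → (∀ x → x ≢ a → h x ≡ 0) → ∑ (h except a) ≡ 0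
    ∑-except-zero {h} a h≡0 = ∑-zero pointwise
      where
      pointwise : ∀ x → (h except a) x ≡ 0
      pointwise x with x ≟ a
      ... | yes _ = refl
      ... | no x≢a = h≡0 x x≢a

    except-support : ∀ {h a x} → (h except a) x ≢ 0 → x ≢ a
    except-support {h} {a} {x} hx≢0 x≡a = hx≢0 (if-yes (x ≟ a) x≡a)

    ∑-const-1 : ∑ (λ _ → 1) ≡ n
    ∑-const-1 = sum-const-1 n

    ∑-except-const-1 : ∀ a → ∑ ((λ _ → 1) except a) ≡ n ∸ 1
    ∑-except-const-1 a = cong (_∸ 1) (trans (sym (∑-pick _ a)) ∑-const-1)

    ∑-indicator : ∀ a → ∑ (λ x → [ x ≟ a ]) ≡ 1
    ∑-indicator a = trans (∑-pick (λ x → [ x ≟ a ]) a) (cong₂ _+_ (if-yes (a ≟ a) refl) (∑-zero rest))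
      where
      rest : ∀ x → ((λ x → [ x ≟ a ]) except a) x ≡ 0
      rest x with x ≟ a
      ... | yes _ = refl
      ... | no _ = refl

    ∑-indicator′ : ∀ a → ∑ (λ x → [ a ≟ x ]) ≡ 1
    ∑-indicator′ a = trans (∑-cong (λ x → []-cong (mk⇔ sym sym) (a ≟ x) (x ≟ a))) (∑-indicator a)

    ∑-fibres : ∀ (f : A → A) → ∑ (λ y → ∑ (λ x → [ f x ≟ y ])) ≡ n
    ∑-fibres f = trans (sym (∑-swap λ x y → [ f x ≟ y ]))
                       (trans (∑-cong (λ x → ∑-indicator′ (f x))) ∑-const-1)

    ∑-nonzero : ∀ h → ∑ h ≢ 0 → ∃ λ x → h x ≢ 0
    ∑-nonzero h ∑h≢0 with sum-nonzero (h ∘ to) ∑h≢0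
    ... | i , hᵢ≢0 = to i , hᵢ≢0

    -- Pair x with σ x: the points preceding their partner in the enumeration carry half of the sum.
    ∑-even : ∀ (h : A → ℕ) (σ : A → A) → (∀ x → σ (σ x) ≡ x) → (∀ x → h (σ x) ≡ h x) →
             (∀ x → h x ≢ 0 → σ x ≢ x) → ∃ λ m → ∑ h ≡ m + m
    ∑-even h σ σσ hσ free = ∑ lower , (begin
      ∑ h                           ≡⟨ ∑-cong (λ x → if-split (first x) (h x)) ⟩
      ∑ (λ x → lower x + upper x)   ≡⟨ ∑-distrib lower upper ⟩
      ∑ lower + ∑ upper             ≡⟨ cong (∑ lower +_) (sym (∑-reindex σ σ σσ σσ upper)) ⟩
      ∑ lower + ∑ (upper ∘ σ)       ≡⟨ cong (∑ lower +_) (∑-cong upper∘σ) ⟩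
      ∑ lower + ∑ lower             ∎)
      where
      open ≡-Reasoning
      first : A → Bool
      first x = ⌊ toℕ (from x) ℕ.<? toℕ (from (σ x)) ⌋
      lower upper : A → ℕ
      lower x = if first x then h x else 0
      upper x = if first x then 0 else h x
      upper∘σ : ∀ x → upper (σ x) ≡ lower x
      upper∘σ x rewrite σσ x | hσ x = if-<-swap (h x) λ hx≢0 same-index → free x hx≢0
        (trans (sym (strictlyInverseˡ (σ x)))
          (trans (cong to (Fin.toℕ-injective (sym same-index))) (strictlyInverseˡ x)))

open Summation

module Arithmetic where
  open import Data.Nat using (_+_; _*_)
  open import Data.Nat.Tactic.RingSolver using (solve)
  open import Data.List using (_∷_; [])

  double≡*2 : ∀ m → m + m ≡ m * 2
  double≡*2 m = trans (cong (m +_) (sym (ℕ.+-identityʳ m))) (ℕ.*-comm 2 m)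

  double-mod-2 : ∀ m → (m + m) % 2 ≡ 0
  double-mod-2 m = trans (cong (_% 2) (double≡*2 m)) (m*n%n≡0 m 2)

  half-double : ∀ m → (m + m) / 2 ≡ m
  half-double m = trans (cong (_/ 2) (double≡*2 m)) (m*n/n≡m m 2)

  half-2+ : ∀ n → (2 + n) / 2 ≡ suc (n / 2)
  half-2+ n = m/n≡1+[m∸n]/n {2 + n} {2} (ℕ.s≤s (ℕ.s≤s ℕ.z≤n))

  quadruple-mod-4 : ∀ r h → (r + ((h + h) + (h + h))) % 4 ≡ r % 4
  quadruple-mod-4 r h = trans (cong (λ n → (r + n) % 4) quadruple) ([m+kn]%n≡m%n r h 4)
    where
    quadruple : (h + h) + (h + h) ≡ h * 4
    quadruple = trans (double≡*2 (h + h)) (trans (cong (_* 2) (double≡*2 h)) (ℕ.*-assoc h 2 2))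

  compare-counts : ∀ {q m t₀ t₁ t₂} → q ≡ suc (t₀ + (t₁ + t₂)) → m + (t₁ + (t₂ + t₂)) ≡ q → suc t₀ ≡ m + t₂
  compare-counts {q} {m} {t₀} {t₁} {t₂} nonzeros total =
    ℕ.+-cancelʳ-≡ (t₁ + t₂) (suc t₀) (m + t₂) (trans (sym nonzeros) (trans (sym total) (solve (m ∷ t₁ ∷ t₂ ∷ []))))

  -- m is the multiplicity of the value 0 and t_j the number of nonzero values taken j times.
  record MultiplicityCounts (q m t₀ t₁ t₂ : ℕ) : Set where
    constructor multiplicityCounts
    field
      t₀-relation : suc t₀ ≡ m + t₂
      total : m + (t₁ + (t₂ + t₂)) ≡ q
      t₁-values : t₁ ≡ 0 ⊎ t₁ ≡ 2
      t₂-even : ∃ λ h → t₂ ≡ h + h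

  half-4+4h : ∀ h → (4 + ((h + h) + (h + h))) / 2 ≡ 2 + (h + h)
  half-4+4h h = trans (half-2+ (2 + quad)) (cong suc (trans (half-2+ quad) (cong suc (half-double (h + h)))))
    where quad = (h + h) + (h + h)

  square-1-mod-4 : ∀ {q m t₀ t₁ t₂} → MultiplicityCounts q m t₀ t₁ t₂ → m ≡ 3 → q % 4 ≡ 1 →
                   (t₀ ≡ (q ∸ 1) / 2) × (t₁ ≡ 2) × (t₂ ≡ (q ∸ 5) / 2)
  square-1-mod-4 (multiplicityCounts refl refl (inj₁ refl) (h , refl)) refl q≡1
    with () ← trans (sym (quadruple-mod-4 3 h)) q≡1
  square-1-mod-4 (multiplicityCounts refl refl (inj₂ refl) (h , refl)) refl _ =
    sym (half-4+4h h) , refl , sym (half-double (h + h))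

  nonsquare-1-mod-4 : ∀ {q m t₀ t₁ t₂} → MultiplicityCounts q m t₀ t₁ t₂ → m ≡ 1 → q % 4 ≡ 1 →
                      (t₀ ≡ (q ∸ 1) / 2) × (t₁ ≡ 0) × (t₂ ≡ (q ∸ 1) / 2)
  nonsquare-1-mod-4 (multiplicityCounts refl refl (inj₁ refl) (h , refl)) refl _ =
    sym (half-double (h + h)) , refl , sym (half-double (h + h))
  nonsquare-1-mod-4 (multiplicityCounts refl refl (inj₂ refl) (h , refl)) refl q≡1
    with () ← trans (sym (quadruple-mod-4 3 h)) q≡1

  square-3-mod-4 : ∀ {q m t₀ t₁ t₂} → MultiplicityCounts q m t₀ t₁ t₂ → m ≡ 3 → q % 4 ≡ 3 →
                   (t₀ ≡ (q + 1) / 2) × (t₁ ≡ 0) × (t₂ ≡ (q ∸ 3) / 2)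
  square-3-mod-4 (multiplicityCounts refl refl (inj₁ refl) (h , refl)) refl _ =
    sym (trans (cong (λ n → (3 + n) / 2) (ℕ.+-comm ((h + h) + (h + h)) 1)) (half-4+4h h))
    , refl , sym (half-double (h + h))
  square-3-mod-4 (multiplicityCounts refl refl (inj₂ refl) (h , refl)) refl q≡3
    with () ← trans (sym (quadruple-mod-4 5 h)) q≡3

  nonsquare-3-mod-4 : ∀ {q m t₀ t₁ t₂} → MultiplicityCounts q m t₀ t₁ t₂ → m ≡ 1 → q % 4 ≡ 3 →
                      (t₀ ≡ (q ∸ 3) / 2) × (t₁ ≡ 2) × (t₂ ≡ (q ∸ 3) / 2)
  nonsquare-3-mod-4 (multiplicityCounts refl refl (inj₁ refl) (h , refl)) refl q≡3
    with () ← trans (sym (quadruple-mod-4 1 h)) q≡3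
  nonsquare-3-mod-4 (multiplicityCounts refl refl (inj₂ refl) (h , refl)) refl _ =
    sym (half-double (h + h)) , refl , sym (half-double (h + h))

  indicator-partition : ∀ {v} → v ℕ.≤ 2 → 1 ≡ [ v ℕ.≟ 0 ] + ([ v ℕ.≟ 1 ] + [ v ℕ.≟ 2 ])
  indicator-partition ℕ.z≤n = refl
  indicator-partition (ℕ.s≤s ℕ.z≤n) = refl
  indicator-partition (ℕ.s≤s (ℕ.s≤s ℕ.z≤n)) = refl

  indicator-weights : ∀ {v} → v ℕ.≤ 2 → v ≡ [ v ℕ.≟ 1 ] + ([ v ℕ.≟ 2 ] + [ v ℕ.≟ 2 ])
  indicator-weights ℕ.z≤n = refl
  indicator-weights (ℕ.s≤s ℕ.z≤n) = refl
  indicator-weights (ℕ.s≤s (ℕ.s≤s ℕ.z≤n)) = refl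

open Arithmetic

module FieldProperties {q} (F : FiniteField q) where
  open FiniteField F

  commutativeRing : CommutativeRing _ _
  commutativeRing = record { isCommutativeRing = isCommutativeRing }

  open CommutativeRing commutativeRing
    using ( +-assoc; +-identityʳ; -‿inverseʳ; *-comm; *-identityˡ; *-identityʳ; zeroˡ; zeroʳ
          ; ring; commutativeSemiring; *-commutativeMonoid)
  open RingProperties ring
    using (-‿involutive; -0#≈0#; +-cancelˡ; -‿distribˡ-*; -‿distribʳ-*; //-rightDividesˡ; //-rightDividesʳ;
           x∙y⁻¹≈ε⇒x≈y; +-inverseˡ-unique)
  open import Algebra.Solver.Ring.NaturalCoefficients.Default commutativeSemiring
  open Counting enum _≟_ public
  open FiniteSum *-commutativeMonoid enum using ()
    renaming (∑ to ∏; ∑-cong to ∏-cong; ∑-distrib to ∏-distrib; ∑-reindex to ∏-reindex)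
  open CommutativeMonoidSum *-commutativeMonoid using () renaming (sum to product)

  two : Carrier
  two = 1# + 1#

  inverse-cancel : ∀ {a a⁻¹} → a * a⁻¹ ≡ 1# → ∀ b → a⁻¹ * (a * b) ≡ b
  inverse-cancel {a} {a⁻¹} aa⁻¹≡1 b = begin
    a⁻¹ * (a * b)  ≡⟨ solve 3 (λ a a⁻¹ b → a⁻¹ :* (a :* b) := (a :* a⁻¹) :* b) refl a a⁻¹ b ⟩
    (a * a⁻¹) * b  ≡⟨ cong (_* b) aa⁻¹≡1 ⟩
    1# * b         ≡⟨ *-identityˡ b ⟩
    b              ∎
    where open ≡-Reasoning

  *-cancelˡ-nonzero : ∀ {a} b d → a ≢ 0# → a * b ≡ a * d → b ≡ d
  *-cancelˡ-nonzero {a} b d a≢0 ab≡ad with inverse a a≢0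
  ... | a⁻¹ , aa⁻¹≡1 = trans (sym (inverse-cancel aa⁻¹≡1 b))
                             (trans (cong (a⁻¹ *_) ab≡ad) (inverse-cancel aa⁻¹≡1 d))

  -≡⇔≡+ : ∀ {x y z} → x - y ≡ z ⇔ x ≡ z + y
  -≡⇔≡+ {x} {y} {z} = mk⇔ (λ x-y≡z → trans (sym (//-rightDividesˡ y x)) (cong (_+ y) x-y≡z))
                          (λ x≡z+y → trans (cong (_- y) x≡z+y) (//-rightDividesʳ y z))

  +-cancel⇔ : ∀ {a b d} → b ≡ d ⇔ a + b ≡ a + d
  +-cancel⇔ {a} {b} {d} = mk⇔ (cong (a +_)) (+-cancelˡ a b d)

  *-cancel⇔ : ∀ {a b d} → a ≢ 0# → b ≡ d ⇔ a * b ≡ a * d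
  *-cancel⇔ {a} {b} {d} a≢0 = mk⇔ (cong (a *_)) (*-cancelˡ-nonzero b d a≢0)

  *-zero-product : ∀ {a b} → a * b ≡ 0# → a ≡ 0# ⊎ b ≡ 0#
  *-zero-product {a} {b} ab≡0 with a ≟ 0#
  ... | yes a≡0 = inj₁ a≡0
  ... | no a≢0 = inj₂ (*-cancelˡ-nonzero b 0# a≢0 (trans ab≡0 (sym (zeroʳ a))))

  *-nonzero : ∀ {a b} → a ≢ 0# → b ≢ 0# → a * b ≢ 0#
  *-nonzero a≢0 b≢0 ab≡0 = [ a≢0 , b≢0 ]′ (*-zero-product ab≡0)

  -‿nonzero : ∀ {a} → a ≢ 0# → - a ≢ 0#
  -‿nonzero {a} a≢0 -a≡0 = a≢0 (trans (sym (-‿involutive a)) (trans (cong -_ -a≡0) -0#≈0#))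

  -x*-x : ∀ x → (- x) * (- x) ≡ x * x
  -x*-x x = trans (sym (-‿distribˡ-* x (- x)))
                  (trans (cong -_ (sym (-‿distribʳ-* x x))) (-‿involutive (x * x)))

  -- (x - z)(x + z) = 0, written with n = - z so that the solver sees a semiring identity.
  square-roots : ∀ {x z} → x * x ≡ z * z → x ≡ z ⊎ x ≡ - z
  square-roots {x} {z} xx≡zz with *-zero-product difference-of-squares
    where
    difference-of-squares : (x - z) * (x + z) ≡ 0#
    difference-of-squares = begin
      (x - z) * (x + z)                ≡⟨ solve 3 (λ x z n → (x :+ n) :* (x :+ z) := x :* x :+ n :* z :+ x :* (z :+ n)) refl x z (- z) ⟩
      x * x + (- z) * z + x * (z - z)  ≡⟨ cong₂ (λ u v → x * x + u + x * v) (sym (-‿distribˡ-* z z)) (-‿inverseʳ z) ⟩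
      x * x - z * z + x * 0#           ≡⟨ cong₂ (λ u v → u - z * z + v) xx≡zz (zeroʳ x) ⟩
      z * z - z * z + 0#               ≡⟨ trans (+-identityʳ _) (-‿inverseʳ (z * z)) ⟩
      0#                               ∎
      where open ≡-Reasoning
  ... | inj₁ x-z≡0 = inj₁ (x∙y⁻¹≈ε⇒x≈y x z x-z≡0)
  ... | inj₂ x+z≡0 = inj₂ (+-inverseˡ-unique x z x+z≡0)

  affine⁻¹ : ∀ {a} → a ≢ 0# → Carrier → Carrier → Carrier
  affine⁻¹ {a} a≢0 b z = proj₁ (inverse a a≢0) * (z - b)

  affine∘affine⁻¹ : ∀ {a} (a≢0 : a ≢ 0#) b z → a * affine⁻¹ a≢0 b z + b ≡ z
  affine∘affine⁻¹ {a} a≢0 b z with inverse a a≢0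
  ... | a⁻¹ , aa⁻¹≡1 = trans (cong (_+ b) (inverse-cancel (trans (*-comm a⁻¹ a) aa⁻¹≡1) (z - b)))
                             (//-rightDividesˡ b z)

  affine⁻¹∘affine : ∀ {a} (a≢0 : a ≢ 0#) b x → affine⁻¹ a≢0 b (a * x + b) ≡ x
  affine⁻¹∘affine {a} a≢0 b x with inverse a a≢0
  ... | a⁻¹ , aa⁻¹≡1 = trans (cong (a⁻¹ *_) (//-rightDividesʳ b (a * x))) (inverse-cancel aa⁻¹≡1 x)

  ∑-affine : ∀ {a} → a ≢ 0# → ∀ b (f : Carrier → ℕ) → ∑ (λ x → f (a * x + b)) ≡ ∑ f
  ∑-affine {a} a≢0 b = ∑-reindex (λ x → a * x + b) (affine⁻¹ a≢0 b)
                                 (affine∘affine⁻¹ a≢0 b) (affine⁻¹∘affine a≢0 b)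

  product-if-power : ∀ {m} (b : Fin m → Bool) x →
                     product (λ i → if b i then 1# else x) ≡ x ^ NatSum.sum (λ i → if b i then 0 else 1)
  product-if-power {zero} b x = refl
  product-if-power {suc m} b x with b Fin.zero
  ... | true = trans (*-identityˡ _) (product-if-power (b ∘ Fin.suc) x)
  ... | false = cong (x *_) (product-if-power (b ∘ Fin.suc) x)

  product-nonzero : ∀ {m} (f : Fin m → Carrier) → (∀ i → f i ≢ 0#) → product f ≢ 0#
  product-nonzero {zero} f _ 1≡0 = 0≢1 (sym 1≡0)
  product-nonzero {suc m} f f≢0 = *-nonzero (f≢0 Fin.zero) (product-nonzero (f ∘ Fin.suc) (f≢0 ∘ Fin.suc))

  -- Multiplying by a permutes the nonzero elements, so a^(q-1) fixes their (nonzero) product.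
  fermat : ∀ {a} → a ≢ 0# → a ^ (q ∸ 1) ≡ 1#
  fermat {a} a≢0 = *-cancelˡ-nonzero _ _ P≢0 (trans (*-comm P _) (trans scaled-product (sym (*-identityʳ P))))
    where
    nonzero-part : Carrier → Carrier
    nonzero-part z = if ⌊ z ≟ 0# ⌋ then 1# else z
    P : Carrier
    P = ∏ nonzero-part
    P≢0 : P ≢ 0#
    P≢0 = product-nonzero _ λ i → nonzero-part-nonzero (elt i)
      where
      nonzero-part-nonzero : ∀ z → nonzero-part z ≢ 0#
      nonzero-part-nonzero z with z ≟ 0#
      ... | yes _ = λ 1≡0 → 0≢1 (sym 1≡0)
      ... | no z≢0 = z≢0
    a-or-1 : Carrier → Carrier
    a-or-1 z = if ⌊ z ≟ 0# ⌋ then 1# else a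
    scale : ∀ z → nonzero-part (a * z + 0#) ≡ a-or-1 z * nonzero-part z
    scale z with z ≟ 0#
    ... | yes refl = trans (cong nonzero-part (trans (+-identityʳ _) (zeroʳ a)))
                           (trans (if-yes (0# ≟ 0#) refl) (sym (*-identityˡ 1#)))
    ... | no z≢0 = trans (if-no ((a * z + 0#) ≟ 0#) az≢0) (+-identityʳ (a * z))
      where
      az≢0 : a * z + 0# ≢ 0#
      az≢0 az≡0 = *-nonzero a≢0 z≢0 (trans (sym (+-identityʳ _)) az≡0)
    scaled-product : a ^ (q ∸ 1) * P ≡ P
    scaled-product = begin
      a ^ (q ∸ 1) * P                        ≡⟨ cong (λ n → a ^ n * P) (sym (∑-except-const-1 0#)) ⟩
      a ^ ∑ ((λ _ → 1) except 0#) * P         ≡⟨ cong (_* P) (sym (product-if-power (λ i → ⌊ elt i ≟ 0# ⌋) a)) ⟩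
      ∏ a-or-1 * P                           ≡⟨ sym (∏-distrib a-or-1 nonzero-part) ⟩
      ∏ (λ z → a-or-1 z * nonzero-part z)    ≡⟨ ∏-cong (λ z → sym (scale z)) ⟩
      ∏ (λ z → nonzero-part (a * z + 0#))    ≡⟨ ∏-reindex (λ x → a * x + 0#) (affine⁻¹ a≢0 0#) (affine∘affine⁻¹ a≢0 0#) (affine⁻¹∘affine a≢0 0#) nonzero-part ⟩
      P ∎
      where open ≡-Reasoning

  #√ : Carrier → ℕ
  #√ a = ∑ (λ z → [ (z * z) ≟ a ])

  #√-zero : #√ 0# ≡ 1
  #√-zero = trans (∑-cong λ z → []-cong zz≡0⇔z≡0 ((z * z) ≟ 0#) (z ≟ 0#)) (∑-indicator 0#)
    where
    zz≡0⇔z≡0 : ∀ {z} → z * z ≡ 0# ⇔ z ≡ 0#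
    zz≡0⇔z≡0 {z} = mk⇔ (λ zz≡0 → [ id , id ]′ (*-zero-product zz≡0)) (λ z≡0 → trans (cong (_* z) z≡0) (zeroˡ z))

  #√-nonsquare : ∀ {a} → ¬ (∃ λ w → w * w ≡ a) → #√ a ≡ 0
  #√-nonsquare {a} no-root = ∑-zero λ z → if-no ((z * z) ≟ a) λ zz≡a → no-root (z , zz≡a)

  module OddOrder (q-odd : q % 2 ≡ 1) where

    -- If 1 + 1 = 0 then x ↦ x + 1 pairs off the elements of F, making q even.
    two≢0 : two ≢ 0#
    two≢0 two≡0 = ℕ.0≢1+n (trans (sym (double-mod-2 half)) (trans (cong (_% 2) (sym q≡half+half)) q-odd))
      where
      shift-involutive : ∀ x → x + 1# + 1# ≡ x
      shift-involutive x = trans (+-assoc x 1# 1#) (trans (cong (x +_) two≡0) (+-identityʳ x))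
      shift-fixed-point-free : ∀ x → 1 ≢ 0 → x + 1# ≢ x
      shift-fixed-point-free x _ x+1≡x = 0≢1 (sym (+-cancelˡ x 1# 0# (trans x+1≡x (sym (+-identityʳ x)))))
      q-even : ∃ λ m → ∑ (λ _ → 1) ≡ m ℕ.+ m
      q-even = ∑-even (λ _ → 1) (_+ 1#) shift-involutive (λ _ → refl) shift-fixed-point-free
      half : ℕ
      half = proj₁ q-even
      q≡half+half : q ≡ half ℕ.+ half
      q≡half+half = trans (sym ∑-const-1) (proj₂ q-even)

    x≢-x : ∀ {x} → x ≢ 0# → x ≢ - x
    x≢-x {x} x≢0 x≡-x = *-nonzero two≢0 x≢0 (begin
      two * x   ≡⟨ solve 1 (λ x → con 2 :* x := x :+ x) refl x ⟩
      x + x     ≡⟨ cong (x +_) x≡-x ⟩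
      x - x     ≡⟨ -‿inverseʳ x ⟩
      0#        ∎)
      where open ≡-Reasoning

    #√-square : ∀ {w a} → w ≢ 0# → w * w ≡ a → #√ a ≡ 2
    #√-square {w} {a} w≢0 ww≡a = begin
      #√ a                                     ≡⟨ ∑-cong split-roots ⟩
      ∑ (λ z → [ z ≟ w ] ℕ.+ [ z ≟ (- w) ])    ≡⟨ ∑-distrib (λ z → [ z ≟ w ]) (λ z → [ z ≟ (- w) ]) ⟩
      ∑ (λ z → [ z ≟ w ]) ℕ.+ ∑ (λ z → [ z ≟ (- w) ])  ≡⟨ cong₂ ℕ._+_ (∑-indicator w) (∑-indicator (- w)) ⟩
      2                                        ∎
      where
      open ≡-Reasoning
      roots : ∀ {z} → z * z ≡ a ⇔ (z ≡ w ⊎ z ≡ - w)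
      roots {z} = mk⇔ (λ zz≡a → square-roots (trans zz≡a (sym ww≡a)))
                      [ (λ z≡w → trans (cong (λ t → t * t) z≡w) ww≡a)
                      , (λ z≡-w → trans (cong (λ t → t * t) z≡-w) (trans (-x*-x w) ww≡a)) ]′
      split-roots : ∀ z → [ (z * z) ≟ a ] ≡ [ z ≟ w ] ℕ.+ [ z ≟ (- w) ]
      split-roots z = []-⊎ roots (λ z≡w z≡-w → x≢-x w≢0 (trans (sym z≡w) z≡-w)) ((z * z) ≟ a) (z ≟ w) (z ≟ (- w))

    #√-nonzero : ∀ {a} → a ≢ 0# → #√ a ≡ 0 ⊎ #√ a ≡ 2
    #√-nonzero {a} a≢0 with #√ a ℕ.≟ 0
    ... | yes no-roots = inj₁ no-roots
    ... | no some-root with ∑-nonzero _ some-root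
    ...   | w , [ww≟a]≢0 = inj₂ (#√-square w≢0 ww≡a)
      where
      ww≡a : w * w ≡ a
      ww≡a = []-witness ((w * w) ≟ a) [ww≟a]≢0
      w≢0 : w ≢ 0#
      w≢0 w≡0 = a≢0 (trans (sym ww≡a) (trans (cong (_* w) w≡0) (zeroˡ w)))

    #√≡1⇔ : ∀ {a} → #√ a ≡ 1 ⇔ a ≡ 0#
    #√≡1⇔ {a} = mk⇔ nonzero-impossible (λ a≡0 → trans (cong #√ a≡0) #√-zero)
      where
      nonzero-impossible : #√ a ≡ 1 → a ≡ 0#
      nonzero-impossible #√a≡1 with a ≟ 0#
      ... | yes a≡0 = a≡0
      ... | no a≢0 = ⊥-elim ([ (λ ≡0 → ℕ.1+n≢0 (trans (sym #√a≡1) ≡0))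
                              , (λ ≡2 → ℕ.0≢1+n (ℕ.suc-injective (trans (sym #√a≡1) ≡2))) ]′ (#√-nonzero a≢0))

    #√≤2 : ∀ a → #√ a ℕ.≤ 2
    #√≤2 a with a ≟ 0#
    ... | yes a≡0 = subst (ℕ._≤ 2) (sym (trans (cong #√ a≡0) #√-zero)) (ℕ.s≤s ℕ.z≤n)
    ... | no a≢0 = [ (λ #√a≡0 → subst (ℕ._≤ 2) (sym #√a≡0) ℕ.z≤n)
                   , (λ #√a≡2 → subst (ℕ._≤ 2) (sym #√a≡2) ℕ.≤-refl) ]′ (#√-nonzero a≢0)

module InversePower (k : ℕ) (F : FiniteField (suc (suc (suc k)))) (q-odd : suc (suc (suc k)) % 2 ≡ 1) where
  open FiniteField F
  open FieldProperties F
  open OddOrder q-odd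
  open CommutativeRing commutativeRing
    using (+-comm; +-identityˡ; +-identityʳ; -‿inverseˡ; *-comm; *-identityˡ; *-identityʳ; zeroˡ; zeroʳ; ring; commutativeSemiring)
  open RingProperties ring using (-0#≈0#; -‿involutive; +-cancelˡ; +-inverseˡ-unique)
  open import Algebra.Solver.Ring.NaturalCoefficients.Default commutativeSemiring

  q : ℕ
  q = suc (suc (suc k))

  ι : Carrier → Carrier
  ι x = x ^ suc k

  mult : Carrier → Carrier → ℕ
  mult c y = multiplicity F ι c y

  ι-inverse : ∀ {x} → x ≢ 0# → x * ι x ≡ 1#
  ι-inverse = fermat

  ι-zero : ι 0# ≡ 0#
  ι-zero = zeroˡ (0# ^ k)

  ι-nonzero : ∀ {x} → x ≢ 0# → ι x ≢ 0#
  ι-nonzero {x} x≢0 ιx≡0 = 0≢1 (trans (sym (zeroʳ x)) (trans (cong (x *_) (sym ιx≡0)) (ι-inverse x≢0)))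

  ι-involutive : ∀ x → ι (ι x) ≡ x
  ι-involutive x with x ≟ 0#
  ... | yes refl = trans (cong ι ι-zero) ι-zero
  ... | no x≢0 = *-cancelˡ-nonzero (ι (ι x)) x (ι-nonzero x≢0)
                   (trans (ι-inverse (ι-nonzero x≢0)) (sym (trans (*-comm (ι x) x) (ι-inverse x≢0))))

  ≡ι⇔ : ∀ {x u} → x ≢ 0# → u ≡ ι x ⇔ x * u ≡ 1#
  ≡ι⇔ {x} {u} x≢0 = mk⇔ (λ u≡ιx → trans (cong (x *_) u≡ιx) (ι-inverse x≢0))
                         (λ xu≡1 → *-cancelˡ-nonzero u (ι x) x≢0 (trans xu≡1 (sym (ι-inverse x≢0))))

  mult≡∑ : ∀ c y → mult c y ≡ ∑ (λ x → [ (ι x - c * x) ≟ y ])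
  mult≡∑ c y = count≡sum (λ i → ⌊ (ι (elt i) - c * elt i) ≟ y ⌋)

  M≡∑ : ∀ j c → M F j ι c ≡ ∑ (λ y → [ mult c y ℕ.≟ j ])
  M≡∑ j c = count≡sum (λ i → ⌊ mult c (elt i) ℕ.≟ j ⌋)

  mult-slope-0 : ∀ y → mult 0# y ≡ 1
  mult-slope-0 y = begin
    mult 0# y                          ≡⟨ mult≡∑ 0# y ⟩
    ∑ (λ x → [ (ι x - 0# * x) ≟ y ])   ≡⟨ ∑-cong (λ x → cong (λ t → [ t ≟ y ]) (ι-slope-0 x)) ⟩
    ∑ (λ x → [ ι x ≟ y ])              ≡⟨ ∑-reindex ι ι ι-involutive ι-involutive (λ x → [ x ≟ y ]) ⟩
    ∑ (λ x → [ x ≟ y ])                ≡⟨ ∑-indicator y ⟩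
    1                                  ∎
    where
    open ≡-Reasoning
    ι-slope-0 : ∀ x → ι x - 0# * x ≡ ι x
    ι-slope-0 x = trans (cong (λ t → ι x - t) (zeroˡ x)) (trans (cong (ι x +_) -0#≈0#) (+-identityʳ (ι x)))

  M-slope-0 : (M F 1 ι 0# ≡ q) × (∀ j → j ≢ 1 → M F j ι 0# ≡ 0)
  M-slope-0 = trans (M≡∑ 1 0#) (trans (∑-cong λ y → cong (λ m → [ m ℕ.≟ 1 ]) (mult-slope-0 y)) ∑-const-1)
            , λ j j≢1 → trans (M≡∑ j 0#) (∑-zero λ y →
                trans (cong (λ m → [ m ℕ.≟ j ]) (mult-slope-0 y)) (if-no (1 ℕ.≟ j) (j≢1 ∘ sym)))

  module NonzeroSlope {c} (c≢0 : c ≢ 0#) where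

    4c : Carrier
    4c = two * two * c

    4c≢0 : 4c ≢ 0#
    4c≢0 = *-nonzero (*-nonzero two≢0 two≢0) c≢0

    2c≢0 : two * c ≢ 0#
    2c≢0 = *-nonzero two≢0 c≢0

    disc : Carrier → Carrier
    disc y = y * y + 4c

    e : Carrier → ℕ
    e y = #√ (disc y)

    -- For x ≠ 0, ι x - c x = y says c x² + y x = 1; multiply by 4c and complete the square.
    quadratic : ∀ {x y} → x ≢ 0# → ι x - c * x ≡ y ⇔ (two * c * x + y) * (two * c * x + y) ≡ disc y
    quadratic {x} {y} x≢0 = begin
      (ι x - c * x ≡ y)                         ≈⟨ -≡⇔≡+ ⟩
      (ι x ≡ y + c * x)                         ≈⟨ mk⇔ sym sym ⟩
      (y + c * x ≡ ι x)                         ≡⟨ cong (_≡ ι x) (+-comm y (c * x)) ⟩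
      (c * x + y ≡ ι x)                         ≈⟨ ≡ι⇔ x≢0 ⟩
      (x * (c * x + y) ≡ 1#)                    ≈⟨ *-cancel⇔ 4c≢0 ⟩
      (4c * (x * (c * x + y)) ≡ 4c * 1#)        ≡⟨ cong (4c * (x * (c * x + y)) ≡_) (*-identityʳ 4c) ⟩
      (4c * (x * (c * x + y)) ≡ 4c)             ≈⟨ +-cancel⇔ ⟩
      (y * y + 4c * (x * (c * x + y)) ≡ disc y) ≡⟨ cong (_≡ disc y) (sym completed-square) ⟩
      ((two * c * x + y) * (two * c * x + y) ≡ disc y) ∎
      where
      open import Relation.Binary.Reasoning.Setoid (⇔-setoid 0ℓ)
      completed-square : (two * c * x + y) * (two * c * x + y) ≡ y * y + 4c * (x * (c * x + y))
      completed-square = solve 3 (λ c x y → (con 2 :* c :* x :+ y) :* (con 2 :* c :* x :+ y)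
                                          := y :* y :+ con 2 :* con 2 :* c :* (x :* (c :* x :+ y))) refl c x y

    mult-formula : ∀ y → mult c y ≡ [ 0# ≟ y ] ℕ.+ e y
    mult-formula y = begin
      mult c y                                    ≡⟨ mult≡∑ c y ⟩
      ∑ solution                                  ≡⟨ ∑-pick solution 0# ⟩
      solution 0# ℕ.+ ∑ (solution except 0#)      ≡⟨ cong₂ ℕ._+_ (cong (λ t → [ t ≟ y ]) ι0-c0≡0)
                                                         (∑-except-cong {solution} {completed} 0# λ x x≢0 → []-cong (quadratic x≢0) _ _) ⟩
      [ 0# ≟ y ] ℕ.+ ∑ (completed except 0#)      ≡⟨ cong ([ 0# ≟ y ] ℕ.+_) (∑-except-null completed 0# completed-0) ⟩
      [ 0# ≟ y ] ℕ.+ ∑ completed                  ≡⟨ cong ([ 0# ≟ y ] ℕ.+_) (∑-affine 2c≢0 y (λ z → [ (z * z) ≟ disc y ])) ⟩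
      [ 0# ≟ y ] ℕ.+ e y                          ∎
      where
      open ≡-Reasoning
      solution completed : Carrier → ℕ
      solution x = [ (ι x - c * x) ≟ y ]
      completed x = [ ((two * c * x + y) * (two * c * x + y)) ≟ disc y ]
      ι0-c0≡0 : ι 0# - c * 0# ≡ 0#
      ι0-c0≡0 = trans (cong₂ (λ u v → u - v) ι-zero (zeroʳ c)) (trans (cong (0# +_) -0#≈0#) (+-identityʳ 0#))
      completed-0 : completed 0# ≡ 0
      completed-0 = if-no (_ ≟ disc y) λ [2c0+y]²≡disc → 4c≢0 (sym (+-cancelˡ (y * y) 0# 4c
        (trans (+-identityʳ (y * y)) (trans (cong (λ t → t * t) (sym 2c0+y≡y)) [2c0+y]²≡disc))))
        where
        2c0+y≡y : two * c * 0# + y ≡ y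
        2c0+y≡y = trans (cong (_+ y) (zeroʳ (two * c))) (+-identityˡ y)

    e-is : ℕ → Carrier → ℕ
    e-is j y = [ e y ℕ.≟ j ]

    T : ℕ → ℕ
    T j = ∑ (e-is j except 0#)

    m₀ : ℕ
    m₀ = mult c 0#

    e≤2 : ∀ y → e y ℕ.≤ 2
    e≤2 y = #√≤2 (disc y)

    mult-nonzero : ∀ {y} → y ≢ 0# → mult c y ≡ e y
    mult-nonzero {y} y≢0 = trans (mult-formula y) (cong (ℕ._+ e y) (if-no (0# ≟ y) (y≢0 ∘ sym)))

    profile : ∀ {m} → m₀ ≡ m → ∀ j → M F j ι c ≡ [ m ℕ.≟ j ] ℕ.+ T j
    profile {m} m₀≡m j = begin
      M F j ι c                                                  ≡⟨ M≡∑ j c ⟩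
      ∑ (λ y → [ mult c y ℕ.≟ j ])                               ≡⟨ ∑-pick (λ y → [ mult c y ℕ.≟ j ]) 0# ⟩
      [ m₀ ℕ.≟ j ] ℕ.+ ∑ ((λ y → [ mult c y ℕ.≟ j ]) except 0#)  ≡⟨ cong₂ ℕ._+_ (cong (λ n → [ n ℕ.≟ j ]) m₀≡m)
                                                                      (∑-except-cong {g = e-is j} 0# λ y y≢0 → cong (λ n → [ n ℕ.≟ j ]) (mult-nonzero y≢0)) ⟩
      [ m ℕ.≟ j ] ℕ.+ T j                                        ∎
      where open ≡-Reasoning

    T-above-2 : ∀ {j} → 2 < j → T j ≡ 0
    T-above-2 2<j = ∑-except-zero 0# λ y _ → if-no (e y ℕ.≟ _) (ℕ.<⇒≢ (ℕ.≤-<-trans (e≤2 y) 2<j))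

    M-above : ∀ {m j} → m₀ ≡ m → m < j → 2 < j → M F j ι c ≡ 0
    M-above {m} {j} m₀≡m m<j 2<j = trans (profile m₀≡m j) (cong₂ ℕ._+_ (if-no (m ℕ.≟ j) (ℕ.<⇒≢ m<j)) (T-above-2 2<j))

    nonzero-count : q ≡ suc (T 0 ℕ.+ (T 1 ℕ.+ T 2))
    nonzero-count = cong suc (begin
      q ∸ 1                                       ≡⟨ sym (∑-except-const-1 0#) ⟩
      ∑ ((λ _ → 1) except 0#)                     ≡⟨ ∑-except-cong {g = λ y → e-is 0 y ℕ.+ (e-is 1 y ℕ.+ e-is 2 y)} 0# (λ y _ → indicator-partition (e≤2 y)) ⟩
      ∑ ((λ y → e-is 0 y ℕ.+ (e-is 1 y ℕ.+ e-is 2 y)) except 0#)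
                                                  ≡⟨ ∑-except-distrib (e-is 0) (λ y → e-is 1 y ℕ.+ e-is 2 y) 0# ⟩
      T 0 ℕ.+ ∑ ((λ y → e-is 1 y ℕ.+ e-is 2 y) except 0#)
                                                  ≡⟨ cong (T 0 ℕ.+_) (∑-except-distrib (e-is 1) (e-is 2) 0#) ⟩
      T 0 ℕ.+ (T 1 ℕ.+ T 2)                       ∎)
      where open ≡-Reasoning

    multiplicity-total : m₀ ℕ.+ (T 1 ℕ.+ (T 2 ℕ.+ T 2)) ≡ q
    multiplicity-total = sym (begin
      q                                              ≡⟨ sym (∑-fibres (λ x → ι x - c * x)) ⟩
      ∑ (λ y → ∑ (λ x → [ (ι x - c * x) ≟ y ]))      ≡⟨ ∑-cong (λ y → sym (mult≡∑ c y)) ⟩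
      ∑ (mult c)                                     ≡⟨ ∑-pick (mult c) 0# ⟩
      m₀ ℕ.+ ∑ (mult c except 0#)                    ≡⟨ cong (m₀ ℕ.+_) (∑-except-cong {g = λ y → e-is 1 y ℕ.+ (e-is 2 y ℕ.+ e-is 2 y)} 0#
                                                          λ y y≢0 → trans (mult-nonzero y≢0) (indicator-weights (e≤2 y))) ⟩
      m₀ ℕ.+ ∑ ((λ y → e-is 1 y ℕ.+ (e-is 2 y ℕ.+ e-is 2 y)) except 0#)
                                                     ≡⟨ cong (m₀ ℕ.+_) (∑-except-distrib (e-is 1) (λ y → e-is 2 y ℕ.+ e-is 2 y) 0#) ⟩
      m₀ ℕ.+ (T 1 ℕ.+ ∑ ((λ y → e-is 2 y ℕ.+ e-is 2 y) except 0#))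
                                                     ≡⟨ cong (λ n → m₀ ℕ.+ (T 1 ℕ.+ n)) (∑-except-distrib (e-is 2) (e-is 2) 0#) ⟩
      m₀ ℕ.+ (T 1 ℕ.+ (T 2 ℕ.+ T 2))                 ∎)
      where open ≡-Reasoning

    disc≡0⇔ : ∀ {y} → disc y ≡ 0# ⇔ y * y ≡ - 4c
    disc≡0⇔ {y} = mk⇔ (+-inverseˡ-unique (y * y) 4c) (λ yy≡-4c → trans (cong (_+ 4c) yy≡-4c) (-‿inverseˡ 4c))

    T₁≡#√-4c : T 1 ≡ #√ (- 4c)
    T₁≡#√-4c = begin
      T 1                                          ≡⟨ ∑-except-cong {e-is 1} {root-of--4c} 0# (λ y _ → []-cong (⇔-trans #√≡1⇔ disc≡0⇔) (e y ℕ.≟ 1) ((y * y) ≟ (- 4c))) ⟩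
      ∑ (root-of--4c except 0#)                    ≡⟨ ∑-except-null root-of--4c 0# (if-no ((0# * 0#) ≟ (- 4c)) 00≢-4c) ⟩
      #√ (- 4c)                                ∎
      where
      open ≡-Reasoning
      root-of--4c : Carrier → ℕ
      root-of--4c y = [ (y * y) ≟ (- 4c) ]
      00≢-4c : 0# * 0# ≢ - 4c
      00≢-4c 00≡-4c = -‿nonzero 4c≢0 (trans (sym 00≡-4c) (zeroˡ 0#))

    T₁-values : T 1 ≡ 0 ⊎ T 1 ≡ 2
    T₁-values = Sum.map (trans T₁≡#√-4c) (trans T₁≡#√-4c) (#√-nonzero (-‿nonzero 4c≢0))

    -- y ↦ - y pairs off the nonzero y with e y = 2.
    T₂-even : ∃ λ h → T 2 ≡ h ℕ.+ h
    T₂-even = ∑-even double -_ -‿involutive double-neg free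
      where
      double : Carrier → ℕ
      double = e-is 2 except 0#
      double-neg : ∀ y → double (- y) ≡ double y
      double-neg y with y ≟ 0#
      ... | yes y≡0 = trans (cong double (trans (cong -_ y≡0) -0#≈0#)) (if-yes (0# ≟ 0#) refl)
      ... | no y≢0 = trans (if-no ((- y) ≟ 0#) (-‿nonzero y≢0))
                           (cong (λ n → [ n ℕ.≟ 2 ]) (cong (λ t → #√ (t + 4c)) (-x*-x y)))
      free : ∀ y → double y ≢ 0 → - y ≢ y
      free y double≢0 -y≡y = x≢-x (except-support {e-is 2} double≢0) (sym -y≡y)

    counts : MultiplicityCounts q m₀ (T 0) (T 1) (T 2)
    counts = multiplicityCounts (compare-counts {q} {m₀} {T 0} {T 1} {T 2} nonzero-count multiplicity-total)
                                multiplicity-total T₁-values T₂-even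

    m₀≡1+#√4c : m₀ ≡ 1 ℕ.+ #√ 4c
    m₀≡1+#√4c = trans (mult-formula 0#) (cong₂ ℕ._+_ (if-yes (0# ≟ 0#) refl)
                                                      (cong #√ (trans (cong (_+ 4c) (zeroˡ 0#)) (+-identityˡ 4c))))

    m₀-square : C₀ F c → m₀ ≡ 3
    m₀-square (_ , w , ww≡c) = trans m₀≡1+#√4c (cong suc (#√-square 2w≢0 2w2w≡4c))
      where
      2w≢0 : two * w ≢ 0#
      2w≢0 = *-nonzero two≢0 λ w≡0 → c≢0 (trans (sym ww≡c) (trans (cong (_* w) w≡0) (zeroˡ w)))
      2w2w≡4c : (two * w) * (two * w) ≡ 4c
      2w2w≡4c = trans (solve 1 (λ w → (con 2 :* w) :* (con 2 :* w) := con 2 :* con 2 :* (w :* w)) refl w)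
                      (cong (two * two *_) ww≡c)

    m₀-nonsquare : C₁ F c → m₀ ≡ 1
    m₀-nonsquare (_ , no-root) = trans m₀≡1+#√4c (cong suc (#√-nonsquare no-root-4c))
      where
      ½ : Carrier
      ½ = proj₁ (inverse two two≢0)
      2½≡1 : two * ½ ≡ 1#
      2½≡1 = proj₂ (inverse two two≢0)
      no-root-4c : ¬ ∃ λ v → v * v ≡ 4c
      no-root-4c (v , vv≡4c) = no-root (v * ½ , (begin
        (v * ½) * (v * ½)               ≡⟨ solve 2 (λ v ½ → (v :* ½) :* (v :* ½) := (v :* v) :* (½ :* ½)) refl v ½ ⟩
        (v * v) * (½ * ½)               ≡⟨ cong (_* (½ * ½)) vv≡4c ⟩
        4c * (½ * ½)                    ≡⟨ solve 3 (λ c ½ t → t :* t :* c :* (½ :* ½) := c :* ((t :* ½) :* (t :* ½))) refl c ½ two ⟩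
        c * ((two * ½) * (two * ½))     ≡⟨ cong (λ s → c * (s * s)) 2½≡1 ⟩
        c * (1# * 1#)                   ≡⟨ trans (cong (c *_) (*-identityˡ 1#)) (*-identityʳ c) ⟩
        c                               ∎))
        where open ≡-Reasoning

    square-1 : C₀ F c → q % 4 ≡ 1 →
               (M F 0 ι c ≡ (q ∸ 1) / 2) × (M F 1 ι c ≡ 2) × (M F 2 ι c ≡ (q ∸ 5) / 2)
               × (M F 3 ι c ≡ 1) × (∀ j → 3 < j → M F j ι c ≡ 0)
    square-1 c∈C₀ q≡1 =
      let t₀≡ , t₁≡ , t₂≡ = square-1-mod-4 counts m₀≡3 q≡1
      in trans (at 0) t₀≡ , trans (at 1) t₁≡ , trans (at 2) t₂≡ , trans (at 3) (cong suc (T-above-2 (ℕ.n<1+n 2)))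
         , λ j 3<j → M-above m₀≡3 3<j (ℕ.<-trans (ℕ.n<1+n 2) 3<j)
      where
      m₀≡3 : m₀ ≡ 3
      m₀≡3 = m₀-square c∈C₀
      at : ∀ j → M F j ι c ≡ [ 3 ℕ.≟ j ] ℕ.+ T j
      at = profile m₀≡3

    nonsquare-1 : C₁ F c → q % 4 ≡ 1 →
                  (M F 0 ι c ≡ (q ∸ 1) / 2) × (M F 1 ι c ≡ 1) × (M F 2 ι c ≡ (q ∸ 1) / 2)
                  × (∀ j → 2 < j → M F j ι c ≡ 0)
    nonsquare-1 c∈C₁ q≡1 =
      let t₀≡ , t₁≡ , t₂≡ = nonsquare-1-mod-4 counts m₀≡1 q≡1
      in trans (at 0) t₀≡ , trans (at 1) (cong suc t₁≡) , trans (at 2) t₂≡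
         , λ j 2<j → M-above m₀≡1 (ℕ.<-trans (ℕ.n<1+n 1) 2<j) 2<j
      where
      m₀≡1 : m₀ ≡ 1
      m₀≡1 = m₀-nonsquare c∈C₁
      at : ∀ j → M F j ι c ≡ [ 1 ℕ.≟ j ] ℕ.+ T j
      at = profile m₀≡1

    square-3 : C₀ F c → q % 4 ≡ 3 →
               (M F 0 ι c ≡ (q ℕ.+ 1) / 2) × (M F 1 ι c ≡ 0) × (M F 2 ι c ≡ (q ∸ 3) / 2)
               × (M F 3 ι c ≡ 1) × (∀ j → 3 < j → M F j ι c ≡ 0)
    square-3 c∈C₀ q≡3 =
      let t₀≡ , t₁≡ , t₂≡ = square-3-mod-4 counts m₀≡3 q≡3
      in trans (at 0) t₀≡ , trans (at 1) t₁≡ , trans (at 2) t₂≡ , trans (at 3) (cong suc (T-above-2 (ℕ.n<1+n 2)))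
         , λ j 3<j → M-above m₀≡3 3<j (ℕ.<-trans (ℕ.n<1+n 2) 3<j)
      where
      m₀≡3 : m₀ ≡ 3
      m₀≡3 = m₀-square c∈C₀
      at : ∀ j → M F j ι c ≡ [ 3 ℕ.≟ j ] ℕ.+ T j
      at = profile m₀≡3

    nonsquare-3 : C₁ F c → q % 4 ≡ 3 →
                  (M F 0 ι c ≡ (q ∸ 3) / 2) × (M F 1 ι c ≡ 3) × (M F 2 ι c ≡ (q ∸ 3) / 2)
                  × (∀ j → 2 < j → M F j ι c ≡ 0)
    nonsquare-3 c∈C₁ q≡3 =
      let t₀≡ , t₁≡ , t₂≡ = nonsquare-3-mod-4 counts m₀≡1 q≡3
      in trans (at 0) t₀≡ , trans (at 1) (cong suc t₁≡) , trans (at 2) t₂≡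
         , λ j 2<j → M-above m₀≡1 (ℕ.<-trans (ℕ.n<1+n 1) 2<j) 2<j
      where
      m₀≡1 : m₀ ≡ 1
      m₀≡1 = m₀-nonsquare c∈C₁
      at : ∀ j → M F j ι c ≡ [ 1 ℕ.≟ j ] ℕ.+ T j
      at = profile m₀≡1

no-field-of-order-1 : FiniteField 1 → ⊥
no-field-of-order-1 F = 0≢1 (trans (sym (strictlyInverseˡ 0#)) (trans (cong to (singleton (from 0#) (from 1#))) (strictlyInverseˡ 1#)))
  where
  open FiniteField F
  open Inverse (⤖⇒↔ enum) using (to; from; strictlyInverseˡ)
  singleton : (i j : Fin 1) → i ≡ j
  singleton Fin.zero Fin.zero = refl

open import Data.Nat using (_+_)
import Data.Nat

propositionB5 : (q : ℕ) → q % 2 ≡ 1 → (F : FiniteField q) →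
    let Mj = λ j c → M F j (λ x → FiniteField._^_ F x (q ∸ 2)) c
    in ((Mj 1 (FiniteField.0# F) ≡ q) × (∀ j → j ≢ 1 → Mj j (FiniteField.0# F) ≡ 0))
     × (q % 4 ≡ 1 →
          (∀ c → C₀ F c →
             (Mj 0 c ≡ (q ∸ 1) / 2) × (Mj 1 c ≡ 2) × (Mj 2 c ≡ (q ∸ 5) / 2)
             × (Mj 3 c ≡ 1) × (∀ j → 3 Data.Nat.< j → Mj j c ≡ 0))
        × (∀ c → C₁ F c →
             (Mj 0 c ≡ (q ∸ 1) / 2) × (Mj 1 c ≡ 1) × (Mj 2 c ≡ (q ∸ 1) / 2)
             × (∀ j → 2 Data.Nat.< j → Mj j c ≡ 0)))
     × (q % 4 ≡ 3 →
          (∀ c → C₀ F c →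
             (Mj 0 c ≡ (q + 1) / 2) × (Mj 1 c ≡ 0) × (Mj 2 c ≡ (q ∸ 3) / 2)
             × (Mj 3 c ≡ 1) × (∀ j → 3 Data.Nat.< j → Mj j c ≡ 0))
        × (∀ c → C₁ F c →
             (Mj 0 c ≡ (q ∸ 3) / 2) × (Mj 1 c ≡ 3) × (Mj 2 c ≡ (q ∸ 3) / 2)
             × (∀ j → 2 Data.Nat.< j → Mj j c ≡ 0)))
propositionB5 zero () F
propositionB5 (suc zero) _ F = ⊥-elim (no-field-of-order-1 F)
propositionB5 (suc (suc zero)) () F
propositionB5 (suc (suc (suc k))) q-odd F =
  M-slope-0
  , (λ q≡1 → (λ c c∈C₀ → NonzeroSlope.square-1 (proj₁ c∈C₀) c∈C₀ q≡1)
           , (λ c c∈C₁ → NonzeroSlope.nonsquare-1 (proj₁ c∈C₁) c∈C₁ q≡1))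
  , (λ q≡3 → (λ c c∈C₀ → NonzeroSlope.square-3 (proj₁ c∈C₀) c∈C₀ q≡3)
           , (λ c c∈C₁ → NonzeroSlope.nonsquare-3 (proj₁ c∈C₁) c∈C₁ q≡3))
  where open InversePower k F q-odd
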